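{- Let $r$ be a complex number and $n\ge0$ an integer. Then, as polynomials in $x$, $$D_n^{(r)}(x)^2=\sum_{m=0}^n\binom{n+2r+m}{n-m}(-1)^{n-m}\prod_{j=m+1}^n j(2r+j)\prod_{k=1}^m\big(x^2+(2r+2k-1)^2\big),$$ where empty products equal $1$.
   Context: For a complex number $a$ and integer $k\ge0$, $\binom{a}{k}=a(a-1)\cdots(a-k+1)/k!$. The polynomials $D_n^{(r)}(x)$ are defined by $D_{ -1}^{(r)}(x)=0$, $D_0^{(r)}(x)=1$ and $D_{n+1}^{(r)}(x)=xD_n^{(r)}(x)-n(n+2r)D_{n-1}^{(r)}(x)$ for $n\ge0$. -}

module Defs where

open import Data.Nat using (ℕ; zero; suc; _∸_)
import Data.Nat as ℕ
open import Data.Product using (_×_; _,_; proj₂)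
open import Algebra.Bundles using (CommutativeRing)

-- Everything is parametrised by a commutative ring R (the paper works in ℂ).
module _ {c ℓ} (R : CommutativeRing c ℓ) where
  open CommutativeRing R

  fromℕ : ℕ → Carrier
  fromℕ zero    = 0#
  fromℕ (suc n) = 1# + fromℕ n

  pow : Carrier → ℕ → Carrier
  pow a zero    = 1#
  pow a (suc n) = a * pow a n

  prodFrom : ℕ → ℕ → (ℕ → Carrier) → Carrier
  prodFrom lo zero      f = 1#
  prodFrom lo (suc len) f = f lo * prodFrom (suc lo) len f

  sumTo : ℕ → (ℕ → Carrier) → Carrier
  sumTo zero    f = f 0
  sumTo (suc n) f = sumTo n f + f (suc n)

  falling : Carrier → ℕ → Carrier
  falling a k = prodFrom 0 k (λ i → a - fromℕ i)

  -- Given inv with (fromℕ (i+1)) * inv i ≈ 1, the inverse of k! is ∏_{i=1}^k inv (i-1)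
  invFact : (ℕ → Carrier) → ℕ → Carrier
  invFact inv k = prodFrom 0 k inv

  binom : (ℕ → Carrier) → Carrier → ℕ → Carrier
  binom inv a k = falling a k * invFact inv k

  -- pair (D_{n-1}, D_n) with D_{-1} = 0, D_0 = 1,
  -- D_{n+1} = x D_n - n(n+2r) D_{n-1}
  Dpair : Carrier → Carrier → ℕ → Carrier × Carrier
  Dpair r x zero = 0# , 1#
  Dpair r x (suc n) with Dpair r x n
  ... | (dm , dn) = dn , (x * dn - (fromℕ n * (fromℕ n + (r + r))) * dm)

  D : Carrier → Carrier → ℕ → Carrier
  D r x n = proj₂ (Dpair r x n)

  RHS : (ℕ → Carrier) → Carrier → Carrier → ℕ → Carrier
  RHS inv r x n = sumTo n λ m →
      binom inv (fromℕ n + (r + r) + fromℕ m) (n ∸ m)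
    * pow (- 1#) (n ∸ m)
    * prodFrom (suc m) (n ∸ m) (λ j → fromℕ j * ((r + r) + fromℕ j))
    * prodFrom 1 m (λ k → x * x + pow ((r + r) + fromℕ (k ℕ.+ k) - 1#) 2)

-- With a_n = n(n+2r), the recurrence gives D_{n+1}² = x²D_n² − 2a_n D_n² − 2a_n W_n − a_n² D_{n−1}² for the
-- Turán expression W_n = D_{n+1}D_{n−1} − D_n², and W_{n+1} = a_n W_n + (a_n − a_{n+1}) D_n². In the basis
-- P_m = ∏_{k=1}^m (x² + (2r+2k−1)²), where x² P_m = P_{m+1} − (2r+2m+1)² P_m, induction on n shows that D_n²,
-- D_{n−1}² and a_n W_n have coefficients c_{n,m}, c_{n−1,m} and −a_n (2r+n+m) c_{n−1,m}, where c_{n,m} are the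
-- coefficients of the claimed formula. The induction step amounts to two linear recurrences for the c_{n,m};
-- written in terms of e(m,k) = k! c_{m+k,m}, whose consecutive ratios are polynomials, they become polynomial
-- identities in m, k and r.

module Submission where

open import Defs
open import Data.Nat using (ℕ; suc)
open import Algebra.Bundles using (CommutativeRing)
open import Data.Nat as ℕ using (zero; _∸_; _≤_; _<_; z≤n; s≤s; _≤?_; compare; less; equal; greater)
import Data.Nat.Properties as ℕP
open import Data.Integer as ℤ using (ℤ; +_; -[1+_]; _⊖_; _◃_)
import Data.Integer.Properties as ℤP
open import Data.Sign as Sign using (Sign)
open import Data.Maybe using (Maybe; just; nothing)
open import Data.Product using (proj₁; proj₂)
open import Function using (_∘_)
open import Relation.Nullary using (yes; no; contradiction)
open import Relation.Binary.PropositionalEquality as ≡ using (_≡_)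
open import Algebra.Solver.Ring.AlmostCommutativeRing
  using (fromCommutativeRing; _-Raw-AlmostCommutative⟶_)

-- Stated over bare ring operations so that each expression exists both in R and in the polynomial syntax of the
-- solver (module Syntax below). With N = n, M = m, K = k: α N = a_n, x² + β M turns P_m into P_{m+1},
-- μ N M c_{n−1,m} is the coefficient of W_n, and Λ, Ω give the coefficients of D_{n+1}² and W_{n+1}.
-- For the scaled coefficients e(m,k) = scaledCoeff m k: e(m,k+1) = ρ M K e(m,k), e(m−1,k+2) = Γ M K e(m,k)
-- and e(m−1,1) = Γ₀ M.
module RingExpressions {a} {T : Set a} (add mul : T → T → T) (neg : T → T) (one r : T) where
  infixl 6 _+_ _-_
  infixl 7 _*_
  infix  8 -_

  -_ : T → T
  -_ = neg

  _+_ _*_ _-_ : T → T → T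
  _+_ = add
  _*_ = mul
  x - y = x + - y

  1# : T
  1# = one

  s : T
  s = r + r

  α : T → T
  α y = y * (y + s)

  β : T → T
  β y = z * (z * 1#)
    where
    z : T
    z = s + (1# + y + (1# + y)) - 1#

  μ : T → T → T → T
  μ N M y = - ((s + N + M) * y)

  ρ : T → T → T
  ρ M K = - ((1# + (s + M + M + K)) * α (M + 1# + K))

  Γ : T → T → T
  Γ M K = (s + M + M) * (s + M + M - 1#) * α M * α (M + 1# + K)

  Γ₀ : T → T
  Γ₀ M = - ((s + M + M - 1#) * α M)

  Λ : T → T → T → T → T → T → T
  Λ B N M y₋ y₀ y₁ =
    y₋ - B * y₀ - (1# + 1#) * α N * y₀ - (1# + 1#) * (α N * μ N M y₁) - α N * α N * y₁

  Ω : T → T → T → T → T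
  Ω N M y₁ y₀ = α N * μ N M y₁ + (α N - α (1# + N)) * y₀

module _ {c ℓ} (R : CommutativeRing c ℓ) where
  open CommutativeRing R
  open import Algebra.Properties.Ring ring using (-‿involutive; -‿distribˡ-*; -‿distribʳ-*; -0#≈0#; [y-z]x≈yx-zx)
  open import Algebra.Properties.AbelianGroup +-abelianGroup using (⁻¹-∙-comm)
  open import Algebra.Properties.CommutativeSemigroup +-commutativeSemigroup using (interchange)
  open import Algebra.Properties.CommutativeSemigroup *-commutativeSemigroup using (x∙yz≈y∙xz)
  open import Relation.Binary.Reasoning.Setoid setoid

  -- With the elements of R itself as coefficients the solver could not cancel opposite terms.
  module IntegerCoefficients where
    open import Algebra.Properties.Semiring.Mult.TCOptimised semiring using (_×_; 1+×; ×-homo-+; ×1-homo-*)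

    fromℤ : ℤ → Carrier
    fromℤ (+ n)     = n × 1#
    fromℤ -[1+ n ] = - (suc n × 1#)

    +-cancelˡ-− : ∀ x y z → (x + y) - (x + z) ≈ y - z
    +-cancelˡ-− x y z = begin
      (x + y) - (x + z)      ≈⟨ +-congˡ (⁻¹-∙-comm x z) ⟨
      (x + y) + (- x - z)    ≈⟨ interchange x y (- x) (- z) ⟩
      (x - x) + (y - z)      ≈⟨ +-congʳ (-‿inverseʳ x) ⟩
      0# + (y - z)           ≈⟨ +-identityˡ (y - z) ⟩
      y - z                  ∎

    ⊖-homo : ∀ m n → fromℤ (m ⊖ n) ≈ m × 1# - n × 1#
    ⊖-homo m       zero    = sym (trans (+-congˡ -0#≈0#) (+-identityʳ _))
    ⊖-homo zero    (suc n) = sym (+-identityˡ _)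
    ⊖-homo (suc m) (suc n) = begin
      fromℤ (suc m ⊖ suc n)                      ≡⟨ ≡.cong fromℤ (ℤP.[1+m]⊖[1+n]≡m⊖n m n) ⟩
      fromℤ (m ⊖ n)                              ≈⟨ ⊖-homo m n ⟩
      m × 1# - n × 1#                        ≈⟨ +-cancelˡ-− 1# _ _ ⟨
      (1# + m × 1#) - (1# + n × 1#)          ≈⟨ +-cong (1+× m 1#) (-‿cong (1+× n 1#)) ⟨
      suc m × 1# - suc n × 1#                ∎

    +-homo : ∀ i j → fromℤ (i ℤ.+ j) ≈ fromℤ i + fromℤ j
    +-homo (+ m)      (+ n)      = ×-homo-+ 1# m n
    +-homo (+ m)      -[1+ n ]   = ⊖-homo m (suc n)
    +-homo -[1+ m ]   (+ n)      = trans (⊖-homo n (suc m)) (+-comm _ _)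
    +-homo -[1+ m ]   -[1+ n ]   = begin
      - (suc (suc (m ℕ.+ n)) × 1#)           ≡⟨ ≡.cong (λ k → - (suc k × 1#)) (ℕP.+-suc m n) ⟨
      - ((suc m ℕ.+ suc n) × 1#)             ≈⟨ -‿cong (×-homo-+ 1# (suc m) (suc n)) ⟩
      - (suc m × 1# + suc n × 1#)            ≈⟨ ⁻¹-∙-comm _ _ ⟨
      - (suc m × 1#) - suc n × 1#            ∎

    -‿homo : ∀ i → fromℤ (ℤ.- i) ≈ - fromℤ i
    -‿homo (+ zero)  = sym -0#≈0#
    -‿homo (+ suc n) = refl
    -‿homo -[1+ n ]  = sym (-‿involutive _)

    +◃-homo : ∀ k → fromℤ (Sign.+ ◃ k) ≈ k × 1#
    +◃-homo zero    = refl
    +◃-homo (suc k) = refl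

    -◃-homo : ∀ k → fromℤ (Sign.- ◃ k) ≈ - (k × 1#)
    -◃-homo zero    = sym -0#≈0#
    -◃-homo (suc k) = refl

    *-homo : ∀ i j → fromℤ (i ℤ.* j) ≈ fromℤ i * fromℤ j
    *-homo (+ m)    (+ n)    = trans (+◃-homo (m ℕ.* n)) (×1-homo-* m n)
    *-homo (+ m)    -[1+ n ] = begin
      fromℤ (Sign.- ◃ (m ℕ.* suc n))           ≈⟨ -◃-homo (m ℕ.* suc n) ⟩
      - ((m ℕ.* suc n) × 1#)               ≈⟨ -‿cong (×1-homo-* m (suc n)) ⟩
      - (m × 1# * suc n × 1#)              ≈⟨ -‿distribʳ-* _ _ ⟩
      m × 1# * - (suc n × 1#)              ∎
    *-homo -[1+ m ] (+ n)    = begin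
      fromℤ (Sign.- ◃ (suc m ℕ.* n))           ≈⟨ -◃-homo (suc m ℕ.* n) ⟩
      - ((suc m ℕ.* n) × 1#)               ≈⟨ -‿cong (×1-homo-* (suc m) n) ⟩
      - (suc m × 1# * n × 1#)              ≈⟨ -‿distribˡ-* _ _ ⟩
      - (suc m × 1#) * n × 1#              ∎
    *-homo -[1+ m ] -[1+ n ] = begin
      (suc m ℕ.* suc n) × 1#               ≈⟨ ×1-homo-* (suc m) (suc n) ⟩
      suc m × 1# * suc n × 1#              ≈⟨ -‿involutive _ ⟨
      - - (suc m × 1# * suc n × 1#)        ≈⟨ -‿cong (-‿distribˡ-* _ _) ⟩
      - (- (suc m × 1#) * suc n × 1#)      ≈⟨ -‿distribʳ-* _ _ ⟩
      - (suc m × 1#) * - (suc n × 1#)      ∎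

    homomorphism : ℤ.+-*-rawRing -Raw-AlmostCommutative⟶ fromCommutativeRing R
    homomorphism = record
      { ⟦_⟧ = fromℤ ; +-homo = +-homo ; *-homo = *-homo ; -‿homo = -‿homo
      ; 0-homo = refl ; 1-homo = refl }

    ≟-coefficients : ∀ i j → Maybe (fromℤ i ≈ fromℤ j)
    ≟-coefficients i j with i ℤ.≟ j
    ... | yes ≡.refl = just refl
    ... | no _       = nothing

    open import Algebra.Solver.Ring ℤ.+-*-rawRing (fromCommutativeRing R) homomorphism ≟-coefficients public
      using (solve; _:=_; _:+_; _:*_; _:-_; :-_; con; Polynomial)

  module SumsAndProducts where
    open IntegerCoefficients using (solve; _:=_; _:+_; _:-_; con)

    fromℕ-+ : ∀ m n → fromℕ R (m ℕ.+ n) ≈ fromℕ R m + fromℕ R n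
    fromℕ-+ zero    n = sym (+-identityˡ _)
    fromℕ-+ (suc m) n = trans (+-congˡ (fromℕ-+ m n)) (sym (+-assoc _ _ _))

    prodFrom-cong : ∀ lo len {f g : ℕ → Carrier} → (∀ i → f i ≈ g i) →
                    prodFrom R lo len f ≈ prodFrom R lo len g
    prodFrom-cong lo zero      f≈g = refl
    prodFrom-cong lo (suc len) f≈g = *-cong (f≈g lo) (prodFrom-cong (suc lo) len f≈g)

    prodFrom-suc : ∀ lo len (f : ℕ → Carrier) → prodFrom R (suc lo) len f ≡ prodFrom R lo len (f ∘ suc)
    prodFrom-suc lo zero      f = ≡.refl
    prodFrom-suc lo (suc len) f = ≡.cong (f (suc lo) *_) (prodFrom-suc (suc lo) len f)

    prodFrom-offset : ∀ lo len (f : ℕ → Carrier) → prodFrom R lo len f ≡ prodFrom R 0 len (λ i → f (lo ℕ.+ i))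
    prodFrom-offset zero     len f = ≡.refl
    prodFrom-offset (suc lo) len f = ≡.trans (prodFrom-suc lo len f) (prodFrom-offset lo len (f ∘ suc))

    prodFrom-snoc : ∀ lo len (f : ℕ → Carrier) →
                    prodFrom R lo (suc len) f ≈ prodFrom R lo len f * f (lo ℕ.+ len)
    prodFrom-snoc lo zero      f = trans (*-comm _ _) (*-congˡ (reflexive (≡.cong f (≡.sym (ℕP.+-identityʳ lo)))))
    prodFrom-snoc lo (suc len) f = begin
      f lo * prodFrom R (suc lo) (suc len) f                  ≈⟨ *-congˡ (prodFrom-snoc (suc lo) len f) ⟩
      f lo * (prodFrom R (suc lo) len f * f (suc lo ℕ.+ len)) ≈⟨ *-assoc _ _ _ ⟨
      prodFrom R lo (suc len) f * f (suc lo ℕ.+ len)          ≡⟨ ≡.cong (λ i → prodFrom R lo (suc len) f * f i) (ℕP.+-suc lo len) ⟨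
      prodFrom R lo (suc len) f * f (lo ℕ.+ suc len)          ∎

    falling-cong : ∀ {y z} k → y ≈ z → falling R y k ≈ falling R z k
    falling-cong k y≈z = prodFrom-cong 0 k (λ i → +-congʳ y≈z)

    falling-snoc : ∀ y k → falling R y (suc k) ≈ falling R y k * (y - fromℕ R k)
    falling-snoc y k = prodFrom-snoc 0 k (λ i → y - fromℕ R i)

    falling-1+ : ∀ y k → falling R (1# + y) (suc k) ≈ (1# + y) * falling R y k
    falling-1+ y k = *-cong (solve 1 (λ y → (con (+ 1) :+ y) :- con (+ 0) := con (+ 1) :+ y) refl y)
      (begin
        prodFrom R 1 k (λ i → (1# + y) - fromℕ R i)             ≡⟨ prodFrom-suc 0 k _ ⟩
        prodFrom R 0 k (λ i → (1# + y) - (1# + fromℕ R i))      ≈⟨ prodFrom-cong 0 k (λ i → cancel (fromℕ R i)) ⟩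
        falling R y k                                            ∎)
      where
      cancel : ∀ z → (1# + y) - (1# + z) ≈ y - z
      cancel z = solve 2 (λ y z → (con (+ 1) :+ y) :- (con (+ 1) :+ z) := y :- z) refl y z

    sumTo-cong : ∀ N {f g : ℕ → Carrier} → (∀ i → i ℕ.≤ N → f i ≈ g i) → sumTo R N f ≈ sumTo R N g
    sumTo-cong zero    f≈g = f≈g 0 z≤n
    sumTo-cong (suc N) f≈g =
      +-cong (sumTo-cong N (λ i i≤N → f≈g i (ℕP.m≤n⇒m≤1+n i≤N))) (f≈g (suc N) ℕP.≤-refl)

    sumTo-+ : ∀ N (f g : ℕ → Carrier) → sumTo R N f + sumTo R N g ≈ sumTo R N (λ i → f i + g i)
    sumTo-+ zero    f g = refl
    sumTo-+ (suc N) f g = begin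
      (sumTo R N f + f (suc N)) + (sumTo R N g + g (suc N)) ≈⟨ interchange _ _ _ _ ⟩
      (sumTo R N f + sumTo R N g) + (f (suc N) + g (suc N)) ≈⟨ +-congʳ (sumTo-+ N f g) ⟩
      sumTo R N (λ i → f i + g i) + (f (suc N) + g (suc N)) ∎

    *-distribˡ-sumTo : ∀ N y (f : ℕ → Carrier) → y * sumTo R N f ≈ sumTo R N (λ i → y * f i)
    *-distribˡ-sumTo zero    y f = refl
    *-distribˡ-sumTo (suc N) y f = trans (distribˡ _ _ _) (+-congʳ (*-distribˡ-sumTo N y f))

    -‿distrib-sumTo : ∀ N (f : ℕ → Carrier) → - sumTo R N f ≈ sumTo R N (λ i → - f i)
    -‿distrib-sumTo zero    f = refl
    -‿distrib-sumTo (suc N) f = trans (sym (⁻¹-∙-comm _ _)) (+-congʳ (-‿distrib-sumTo N f))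

    sumTo-− : ∀ N (f g : ℕ → Carrier) → sumTo R N f - sumTo R N g ≈ sumTo R N (λ i → f i - g i)
    sumTo-− N f g = trans (+-congˡ (-‿distrib-sumTo N g)) (sumTo-+ N f (λ i → - g i))

    sumTo-head : ∀ N (f : ℕ → Carrier) → sumTo R (suc N) f ≈ f 0 + sumTo R N (f ∘ suc)
    sumTo-head zero    f = refl
    sumTo-head (suc N) f = trans (+-congʳ (sumTo-head N f)) (+-assoc _ _ _)

    shift : (ℕ → Carrier) → ℕ → Carrier
    shift f zero    = 0#
    shift f (suc i) = f i

    sumTo-dropLast : ∀ N (f : ℕ → Carrier) → f (suc N) ≈ 0# → sumTo R (suc N) f ≈ sumTo R N f
    sumTo-dropLast N f fN≈0 = trans (+-congˡ fN≈0) (+-identityʳ _)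


  module Coefficients (inv : ℕ → Carrier) (inv-correct : ∀ k → fromℕ R (suc k) * inv k ≈ 1#) (r : Carrier) where
    open IntegerCoefficients using (solve; _:=_; _:+_; _:*_; _:-_; :-_; con; Polynomial)
    open SumsAndProducts
    open RingExpressions _+_ _*_ -_ 1# r using (s; α; β; μ; ρ; Γ; Γ₀; Λ; Ω)

    module Syntax {n} (r : Polynomial n) = RingExpressions _:+_ _:*_ :-_ (con (+ 1)) r

    F : ℕ → Carrier
    F = fromℕ R

    α-cong : ∀ {y z} → y ≈ z → α y ≈ α z
    α-cong y≈z = *-cong y≈z (+-congʳ y≈z)

    μ-cong : ∀ {N N′ M y y′} → N ≈ N′ → y ≈ y′ → μ N M y ≈ μ N′ M y′
    μ-cong N≈N′ y≈y′ = -‿cong (*-cong (+-congʳ (+-congˡ N≈N′)) y≈y′)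

    Λ-cong : ∀ {B B′ N N′ M y₋ y₋′ y₀ y₀′ y₁ y₁′} → B ≈ B′ → N ≈ N′ → y₋ ≈ y₋′ → y₀ ≈ y₀′ → y₁ ≈ y₁′ →
             Λ B N M y₋ y₀ y₁ ≈ Λ B′ N′ M y₋′ y₀′ y₁′
    Λ-cong {N = N} {N′ = N′} B≈B′ N≈N′ y₋≈ y₀≈ y₁≈ =
      +-cong (+-cong (+-cong (+-cong y₋≈ (-‿cong (*-cong B≈B′ y₀≈)))
                             (-‿cong (*-cong (*-congˡ αN≈) y₀≈)))
                     (-‿cong (*-congˡ (*-cong αN≈ (μ-cong N≈N′ y₁≈)))))
             (-‿cong (*-cong (*-cong αN≈ αN≈) y₁≈))
      where
      αN≈ : α N ≈ α N′
      αN≈ = α-cong N≈N′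

    Ω-cong : ∀ {N N′ M y₁ y₁′ y₀ y₀′} → N ≈ N′ → y₁ ≈ y₁′ → y₀ ≈ y₀′ → Ω N M y₁ y₀ ≈ Ω N′ M y₁′ y₀′
    Ω-cong N≈N′ y₁≈ y₀≈ =
      +-cong (*-cong (α-cong N≈N′) (μ-cong N≈N′ y₁≈))
             (*-cong (+-cong (α-cong N≈N′) (-‿cong (α-cong (+-congˡ N≈N′)))) y₀≈)

    scaledCoeff : ℕ → ℕ → Carrier
    scaledCoeff m k =
      falling R (s + F m + F m + F k) k * pow R (- 1#) k * prodFrom R 0 k (λ i → α (F m + 1# + F i))

    scaledCoeff-zero : ∀ m → scaledCoeff m 0 ≈ 1#
    scaledCoeff-zero m = trans (*-identityʳ _) (*-identityʳ _)

    scaledCoeff-suc : ∀ m k → scaledCoeff m (suc k) ≈ ρ (F m) (F k) * scaledCoeff m k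
    scaledCoeff-suc m k = begin
      falling R (s + M + M + (1# + K)) (suc k) * (- 1# * PW) * prodFrom R 0 (suc k) g
        ≈⟨ *-cong (*-congʳ falling≈) (prodFrom-snoc 0 k g) ⟩
      (1# + A) * falling R A k * (- 1# * PW) * (prodFrom R 0 k g * α (M + 1# + K))
        ≈⟨ solve 5 (λ Y FA PW PG Z → Y :* FA :* (:- con (+ 1) :* PW) :* (PG :* Z) := :- (Y :* Z) :* (FA :* PW :* PG))
                   refl (1# + A) (falling R A k) PW (prodFrom R 0 k g) (α (M + 1# + K)) ⟩
      ρ M K * scaledCoeff m k ∎
      where
      M K A PW : Carrier
      M = F m
      K = F k
      A = s + M + M + K
      PW = pow R (- 1#) k
      g : ℕ → Carrier
      g i = α (M + 1# + F i)
      falling≈ : falling R (s + M + M + (1# + K)) (suc k) ≈ (1# + A) * falling R A k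
      falling≈ = trans (falling-cong (suc k) (solve 3 (λ M K r → let module S = Syntax r in
                   S.s :+ M :+ M :+ (S.1# :+ K) := S.1# :+ (S.s :+ M :+ M :+ K)) refl M K r))
                 (falling-1+ A k)

    scaledCoeff-shift : ∀ m k → scaledCoeff m (suc (suc k)) ≈ Γ (1# + F m) (F k) * scaledCoeff (suc m) k
    scaledCoeff-shift m k = begin
      falling R B (suc (suc k)) * (- 1# * (- 1# * PW)) * prodFrom R 0 (suc (suc k)) g
        ≈⟨ *-cong (*-congʳ falling≈) product≈ ⟩
      falling R B′ k * (B - K) * (B - (1# + K)) * (- 1# * (- 1# * PW)) * (g 0 * (prodFrom R 0 k g′ * g (suc k)))
        ≈⟨ solve 6 (λ FA PW PG M K r → let module S = Syntax r ; B = S.s :+ M :+ M :+ (S.1# :+ (S.1# :+ K)) in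
              FA :* (B :- K) :* (B :- (S.1# :+ K)) :* (:- S.1# :* (:- S.1# :* PW))
                :* (S.α (M :+ S.1# :+ con (+ 0)) :* (PG :* S.α (M :+ S.1# :+ (S.1# :+ K))))
              := S.Γ (S.1# :+ M) K :* (FA :* PW :* PG))
            refl (falling R B′ k) PW (prodFrom R 0 k g′) M K r ⟩
      Γ (1# + M) K * scaledCoeff (suc m) k ∎
      where
      M K B B′ PW : Carrier
      M = F m
      K = F k
      B = s + M + M + (1# + (1# + K))
      B′ = s + (1# + M) + (1# + M) + K
      PW = pow R (- 1#) k
      g g′ : ℕ → Carrier
      g i = α (M + 1# + F i)
      g′ i = α ((1# + M) + 1# + F i)
      falling≈ : falling R B (suc (suc k)) ≈ falling R B′ k * (B - K) * (B - (1# + K))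
      falling≈ = begin
        falling R B (suc (suc k))                  ≈⟨ falling-snoc B (suc k) ⟩
        falling R B (suc k) * (B - (1# + K))       ≈⟨ *-congʳ (falling-snoc B k) ⟩
        falling R B k * (B - K) * (B - (1# + K))   ≈⟨ *-congʳ (*-congʳ (falling-cong k B≈B′)) ⟩
        falling R B′ k * (B - K) * (B - (1# + K))  ∎
        where
        B≈B′ : B ≈ B′
        B≈B′ = solve 3 (λ M K r → let module S = Syntax r in
                 S.s :+ M :+ M :+ (S.1# :+ (S.1# :+ K)) := S.s :+ (S.1# :+ M) :+ (S.1# :+ M) :+ K) refl M K r
      product≈ : prodFrom R 0 (suc (suc k)) g ≈ g 0 * (prodFrom R 0 k g′ * g (suc k))
      product≈ = *-congˡ (begin
        prodFrom R 1 (suc k) g               ≡⟨ prodFrom-suc 0 (suc k) g ⟩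
        prodFrom R 0 (suc k) (g ∘ suc)       ≈⟨ prodFrom-snoc 0 k (g ∘ suc) ⟩
        prodFrom R 0 k (g ∘ suc) * g (suc k) ≈⟨ *-congʳ (prodFrom-cong 0 k (λ i → α-cong (reassoc (F i)))) ⟩
        prodFrom R 0 k g′ * g (suc k)        ∎)
        where
        reassoc : ∀ X → M + 1# + (1# + X) ≈ (1# + M) + 1# + X
        reassoc X = solve 2 (λ M X → M :+ con (+ 1) :+ (con (+ 1) :+ X) := con (+ 1) :+ M :+ con (+ 1) :+ X) refl M X

    invFact-suc : ∀ k → invFact R inv k ≈ F (suc k) * invFact R inv (suc k)
    invFact-suc k = begin
      invFact R inv k                          ≈⟨ *-identityʳ _ ⟨
      invFact R inv k * 1#                     ≈⟨ *-congˡ (inv-correct k) ⟨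
      invFact R inv k * (F (suc k) * inv k)    ≈⟨ x∙yz≈y∙xz _ _ _ ⟩
      F (suc k) * (invFact R inv k * inv k)    ≈⟨ *-congˡ (prodFrom-snoc 0 k inv) ⟨
      F (suc k) * invFact R inv (suc k)        ∎

    rhsCoeff : ℕ → ℕ → Carrier
    rhsCoeff n m = binom R inv (F n + s + F m) (n ∸ m) * pow R (- 1#) (n ∸ m)
                 * prodFrom R (suc m) (n ∸ m) (λ j → F j * (s + F j))

    rhsCoeff-closed : ∀ m k → rhsCoeff (m ℕ.+ k) m ≈ scaledCoeff m k * invFact R inv k
    rhsCoeff-closed m k rewrite ℕP.m+n∸m≡n m k = begin
      falling R (F (m ℕ.+ k) + s + M) k * invFact R inv k * pow R (- 1#) k * prodFrom R (suc m) k J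
        ≈⟨ *-cong (*-congʳ (*-congʳ (falling-cong k A≈))) (reflexive (prodFrom-offset (suc m) k J)) ⟩
      FA * invFact R inv k * pow R (- 1#) k * prodFrom R 0 k (λ i → J (suc m ℕ.+ i))
        ≈⟨ *-congˡ (prodFrom-cong 0 k (λ i → J≈α (F i) (fromℕ-+ m i))) ⟩
      FA * invFact R inv k * pow R (- 1#) k * prodFrom R 0 k (λ i → α (M + 1# + F i))
        ≈⟨ solve 4 (λ FA IF PW PG → FA :* IF :* PW :* PG := FA :* PW :* PG :* IF) refl _ _ _ _ ⟩
      scaledCoeff m k * invFact R inv k ∎
      where
      M FA : Carrier
      M = F m
      FA = falling R (s + M + M + F k) k
      J : ℕ → Carrier
      J j = F j * (s + F j)
      A≈ : F (m ℕ.+ k) + s + M ≈ s + M + M + F k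
      A≈ = trans (+-congʳ (+-congʳ (fromℕ-+ m k)))
                 (solve 3 (λ M K r → let module S = Syntax r in M :+ K :+ S.s :+ M := S.s :+ M :+ M :+ K) refl M (F k) r)
      J≈α : ∀ {X} Y → X ≈ M + Y → (1# + X) * (s + (1# + X)) ≈ α (M + 1# + Y)
      J≈α {X} Y X≈M+Y = trans (*-cong 1+X≈ (+-congˡ 1+X≈))
        (solve 3 (λ M Y r → let module S = Syntax r in
           (S.1# :+ (M :+ Y)) :* (S.s :+ (S.1# :+ (M :+ Y))) := S.α (M :+ S.1# :+ Y)) refl M Y r)
        where
        1+X≈ : 1# + X ≈ 1# + (M + Y)
        1+X≈ = +-congˡ X≈M+Y

    coeff : ℕ → ℕ → Carrier
    coeff n m with m ≤? n
    ... | yes _ = rhsCoeff n m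
    ... | no  _ = 0#

    coeff-≤ : ∀ {n m} → m ≤ n → coeff n m ≈ rhsCoeff n m
    coeff-≤ {n} {m} m≤n with m ≤? n
    ... | yes _   = refl
    ... | no  m≰n = contradiction m≤n m≰n

    coeff-vanishes : ∀ {n m} → n < m → coeff n m ≈ 0#
    coeff-vanishes {n} {m} n<m with m ≤? n
    ... | yes m≤n = contradiction m≤n (ℕP.<⇒≱ n<m)
    ... | no  _   = refl

    coeff-closed : ∀ m k {n} → m ℕ.+ k ≡ n → coeff n m ≈ scaledCoeff m k * invFact R inv k
    coeff-closed m k ≡.refl = trans (coeff-≤ (ℕP.m≤m+n m k)) (rhsCoeff-closed m k)

    coeff-diagonal : ∀ n → coeff n n ≈ 1#
    coeff-diagonal n = trans (coeff-closed n 0 (ℕP.+-identityʳ n)) (trans (*-identityʳ _) (scaledCoeff-zero n))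

    coeffPrev : ℕ → ℕ → Carrier
    coeffPrev zero    m = 0#
    coeffPrev (suc n) m = coeff n m

    coeffPrev-vanishes : ∀ {n m} → n ≤ m → coeffPrev n m ≈ 0#
    coeffPrev-vanishes {zero}  _   = refl
    coeffPrev-vanishes {suc n} n<m = coeff-vanishes n<m

    coeffShift : ℕ → ℕ → Carrier
    coeffShift n = shift (coeff n)

    turanCoeff : ℕ → ℕ → Carrier
    turanCoeff n m = μ (F n) (F m) (coeffPrev n m)

    -- Γ 0 K and Γ₀ 0 vanish (factor α M), matching the zero shifted coefficient at m = 0.
    coeffShift-interior : ∀ m k →
      coeffShift (suc (m ℕ.+ k)) m ≈ Γ (F m) (F k) * (scaledCoeff m k * invFact R inv (suc (suc k)))
    coeffShift-interior zero    k = solve 3 (λ K w r → con (+ 0) := Syntax.Γ r (con (+ 0)) K :* w) refl (F k) _ r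
    coeffShift-interior (suc m) k = begin
      coeff (suc (suc m ℕ.+ k)) m
        ≈⟨ coeff-closed m (suc (suc k)) (≡.trans (ℕP.+-suc m (suc k)) (≡.cong suc (ℕP.+-suc m k))) ⟩
      scaledCoeff m (suc (suc k)) * invFact R inv (suc (suc k))
        ≈⟨ *-congʳ (scaledCoeff-shift m k) ⟩
      Γ (1# + F m) (F k) * scaledCoeff (suc m) k * invFact R inv (suc (suc k))
        ≈⟨ *-assoc _ _ _ ⟩
      Γ (1# + F m) (F k) * (scaledCoeff (suc m) k * invFact R inv (suc (suc k))) ∎

    coeffShift-diagonal : ∀ m → coeffShift m m ≈ Γ₀ (F m) * invFact R inv 1
    coeffShift-diagonal zero    = solve 2 (λ w r → con (+ 0) := Syntax.Γ₀ r (con (+ 0)) :* w) refl _ r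
    coeffShift-diagonal (suc m) = begin
      coeff (suc m) m                      ≈⟨ coeff-closed m 1 (ℕP.+-comm m 1) ⟩
      scaledCoeff m 1 * invFact R inv 1    ≈⟨ *-congʳ (trans (scaledCoeff-suc m 0) (*-congˡ (scaledCoeff-zero m))) ⟩
      ρ (F m) 0# * 1# * invFact R inv 1    ≈⟨ *-congʳ (solve 2 (λ M r → Syntax.ρ r M (con (+ 0)) :* con (+ 1)
                                                                 := Syntax.Γ₀ r (con (+ 1) :+ M)) refl (F m) r) ⟩
      Γ₀ (1# + F m) * invFact R inv 1      ∎

    Λ-interior : ∀ M K w →
      Λ (β M) (1# + (M + K)) M (Γ M K * w) (ρ M K * (1# + (1# + K)) * w) ((1# + K) * (1# + (1# + K)) * w)
        ≈ ρ M (1# + K) * ρ M K * w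
    Λ-interior M K w = solve 4 (λ M K w r → let module S = Syntax r in
      S.Λ (S.β M) (S.1# :+ (M :+ K)) M (S.Γ M K :* w) (S.ρ M K :* (S.1# :+ (S.1# :+ K)) :* w)
          ((S.1# :+ K) :* (S.1# :+ (S.1# :+ K)) :* w)
      := S.ρ M (S.1# :+ K) :* S.ρ M K :* w) refl M K w r

    Λ-diagonal : ∀ N w → Λ (β N) N N (Γ₀ N * w) ((1# + 0#) * w) (0# * w) ≈ ρ N 0# * w
    Λ-diagonal N w = solve 3 (λ N w r → let module S = Syntax r in
      S.Λ (S.β N) N N (S.Γ₀ N :* w) ((S.1# :+ con (+ 0)) :* w) (con (+ 0) :* w) := S.ρ N (con (+ 0)) :* w) refl N w r

    Ω-interior : ∀ M K w → Ω (1# + (M + K)) M ((1# + K) * w) (ρ M K * w) ≈ μ (1# + (1# + (M + K))) M (ρ M K * w)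
    Ω-interior M K w = solve 4 (λ M K w r → let module S = Syntax r in
      S.Ω (S.1# :+ (M :+ K)) M ((S.1# :+ K) :* w) (S.ρ M K :* w)
      := S.μ (S.1# :+ (S.1# :+ (M :+ K))) M (S.ρ M K :* w)) refl M K w r

    Ω-diagonal : ∀ N → Ω N N 0# 1# ≈ μ (1# + N) N 1#
    Ω-diagonal N = solve 2 (λ N r → let module S = Syntax r in
      S.Ω N N (con (+ 0)) S.1# := S.μ (S.1# :+ N) N S.1#) refl N r

    b : ℕ → Carrier
    b m = pow R (s + F (suc m ℕ.+ suc m) - 1#) 2

    b≈β : ∀ m → b m ≈ β (F m)
    b≈β m = *-cong Z≈ (*-congʳ Z≈)
      where
      Z≈ : s + F (suc m ℕ.+ suc m) - 1# ≈ s + (1# + F m + (1# + F m)) - 1#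
      Z≈ = +-congʳ (+-congˡ (fromℕ-+ (suc m) (suc m)))

    coeff-recurrence-interior : ∀ m k → let n = suc (m ℕ.+ k) in
      Λ (b m) (F n) (F m) (coeffShift n m) (coeff n m) (coeffPrev n m) ≈ coeff (suc n) m
    coeff-recurrence-interior m k = begin
      Λ (b m) (F n) M (coeffShift n m) (coeff n m) (coeff (m ℕ.+ k) m)
        ≈⟨ Λ-cong (b≈β m) (+-congˡ (fromℕ-+ m k)) (coeffShift-interior m k) current previous ⟩
      Λ (β M) (1# + (M + K)) M (Γ M K * w) (ρ M K * (1# + (1# + K)) * w) ((1# + K) * (1# + (1# + K)) * w)
        ≈⟨ Λ-interior M K w ⟩
      ρ M (1# + K) * ρ M K * w
        ≈⟨ next ⟨
      coeff (suc n) m ∎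
      where
      n : ℕ
      n = suc (m ℕ.+ k)
      M K w : Carrier
      M = F m
      K = F k
      w = scaledCoeff m k * invFact R inv (suc (suc k))
      current : coeff n m ≈ ρ M K * (1# + (1# + K)) * w
      current = begin
        coeff n m                                                           ≈⟨ coeff-closed m (suc k) (ℕP.+-suc m k) ⟩
        scaledCoeff m (suc k) * invFact R inv (suc k)                       ≈⟨ *-cong (scaledCoeff-suc m k) (invFact-suc (suc k)) ⟩
        ρ M K * scaledCoeff m k * ((1# + (1# + K)) * invFact R inv (suc (suc k)))
          ≈⟨ solve 4 (λ ρ e F i → ρ :* e :* (F :* i) := ρ :* F :* (e :* i)) refl _ _ _ _ ⟩
        ρ M K * (1# + (1# + K)) * w                                         ∎
      previous : coeff (m ℕ.+ k) m ≈ (1# + K) * (1# + (1# + K)) * w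
      previous = begin
        coeff (m ℕ.+ k) m                                                   ≈⟨ coeff-closed m k ≡.refl ⟩
        scaledCoeff m k * invFact R inv k                                   ≈⟨ *-congˡ (trans (invFact-suc k) (*-congˡ (invFact-suc (suc k)))) ⟩
        scaledCoeff m k * ((1# + K) * ((1# + (1# + K)) * invFact R inv (suc (suc k))))
          ≈⟨ solve 4 (λ e F₁ F₂ i → e :* (F₁ :* (F₂ :* i)) := F₁ :* F₂ :* (e :* i)) refl _ _ _ _ ⟩
        (1# + K) * (1# + (1# + K)) * w                                      ∎
      next : coeff (suc n) m ≈ ρ M (1# + K) * ρ M K * w
      next = begin
        coeff (suc n) m
          ≈⟨ coeff-closed m (suc (suc k)) (≡.trans (ℕP.+-suc m (suc k)) (≡.cong suc (ℕP.+-suc m k))) ⟩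
        scaledCoeff m (suc (suc k)) * invFact R inv (suc (suc k))
          ≈⟨ *-congʳ (trans (scaledCoeff-suc m (suc k)) (*-congˡ (scaledCoeff-suc m k))) ⟩
        ρ M (1# + K) * (ρ M K * scaledCoeff m k) * invFact R inv (suc (suc k))
          ≈⟨ solve 4 (λ ρ₁ ρ₀ e i → ρ₁ :* (ρ₀ :* e) :* i := ρ₁ :* ρ₀ :* (e :* i)) refl _ _ _ _ ⟩
        ρ M (1# + K) * ρ M K * w ∎

    coeff-recurrence-diagonal : ∀ m →
      Λ (b m) (F m) (F m) (coeffShift m m) (coeff m m) (coeffPrev m m) ≈ coeff (suc m) m
    coeff-recurrence-diagonal m = begin
      Λ (b m) M M (coeffShift m m) (coeff m m) (coeffPrev m m)
        ≈⟨ Λ-cong (b≈β m) refl (coeffShift-diagonal m) current (trans (coeffPrev-vanishes (ℕP.≤-refl {m})) (sym (zeroˡ w))) ⟩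
      Λ (β M) M M (Γ₀ M * w) ((1# + 0#) * w) (0# * w)
        ≈⟨ Λ-diagonal M w ⟩
      ρ M 0# * w
        ≈⟨ *-congʳ (trans (*-congˡ (scaledCoeff-zero m)) (*-identityʳ _)) ⟨
      ρ M 0# * scaledCoeff m 0 * w
        ≈⟨ *-congʳ (scaledCoeff-suc m 0) ⟨
      scaledCoeff m 1 * w
        ≈⟨ coeff-closed m 1 (ℕP.+-comm m 1) ⟨
      coeff (suc m) m ∎
      where
      M w : Carrier
      M = F m
      w = invFact R inv 1
      current : coeff m m ≈ (1# + 0#) * w
      current = trans (coeff-diagonal m) (invFact-suc 0)

    coeff-recurrence-justAbove : ∀ n →
      Λ (b (suc n)) (F n) (F (suc n)) (coeffShift n (suc n)) (coeff n (suc n)) (coeffPrev n (suc n)) ≈ coeff (suc n) (suc n)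
    coeff-recurrence-justAbove n = begin
      Λ (b (suc n)) (F n) (F (suc n)) (coeff n n) (coeff n (suc n)) (coeffPrev n (suc n))
        ≈⟨ Λ-cong refl refl (coeff-diagonal n) (coeff-vanishes (ℕP.n<1+n n)) (coeffPrev-vanishes (ℕP.n≤1+n n)) ⟩
      Λ (b (suc n)) (F n) (F (suc n)) 1# 0# 0#
        ≈⟨ solve 4 (λ B N M r → Syntax.Λ r B N M (con (+ 1)) (con (+ 0)) (con (+ 0)) := con (+ 1)) refl _ _ _ r ⟩
      1#
        ≈⟨ coeff-diagonal (suc n) ⟨
      coeff (suc n) (suc n) ∎

    coeff-recurrence-farAbove : ∀ {n m} → suc n < m →
      Λ (b m) (F n) (F m) (coeffShift n m) (coeff n m) (coeffPrev n m) ≈ coeff (suc n) m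
    coeff-recurrence-farAbove {n} {suc m} (s≤s n<m) = begin
      Λ (b (suc m)) (F n) (F (suc m)) (coeff n m) (coeff n (suc m)) (coeffPrev n (suc m))
        ≈⟨ Λ-cong refl refl (coeff-vanishes n<m) (coeff-vanishes (ℕP.m<n⇒m<1+n n<m)) (coeffPrev-vanishes (ℕP.m≤n⇒m≤1+n (ℕP.<⇒≤ n<m))) ⟩
      Λ (b (suc m)) (F n) (F (suc m)) 0# 0# 0#
        ≈⟨ solve 4 (λ B N M r → Syntax.Λ r B N M (con (+ 0)) (con (+ 0)) (con (+ 0)) := con (+ 0)) refl _ _ _ r ⟩
      0#
        ≈⟨ coeff-vanishes (s≤s n<m) ⟨
      coeff (suc n) (suc m) ∎

    coeff-recurrence : ∀ n m →
      Λ (b m) (F n) (F m) (coeffShift n m) (coeff n m) (coeffPrev n m) ≈ coeff (suc n) m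
    coeff-recurrence n m with compare m n
    ... | less m k                                = coeff-recurrence-interior m k
    ... | equal m                                 = coeff-recurrence-diagonal m
    ... | greater n zero rewrite ℕP.+-identityʳ n = coeff-recurrence-justAbove n
    ... | greater n (suc k)                       = coeff-recurrence-farAbove (s≤s (ℕP.m<m+n n (s≤s z≤n)))

    turanCoeff-recurrence-interior : ∀ m k → let n = suc (m ℕ.+ k) in
      Ω (F n) (F m) (coeffPrev n m) (coeff n m) ≈ turanCoeff (suc n) m
    turanCoeff-recurrence-interior m k = begin
      Ω (F n) M (coeff (m ℕ.+ k) m) (coeff n m)         ≈⟨ Ω-cong N≈ previous current ⟩
      Ω (1# + (M + K)) M ((1# + K) * w) (ρ M K * w)     ≈⟨ Ω-interior M K w ⟩
      μ (1# + (1# + (M + K))) M (ρ M K * w)             ≈⟨ μ-cong (+-congˡ N≈) current ⟨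
      μ (1# + F n) M (coeff n m)                        ∎
      where
      n : ℕ
      n = suc (m ℕ.+ k)
      M K w : Carrier
      M = F m
      K = F k
      w = scaledCoeff m k * invFact R inv (suc k)
      N≈ : F n ≈ 1# + (M + K)
      N≈ = +-congˡ (fromℕ-+ m k)
      previous : coeff (m ℕ.+ k) m ≈ (1# + K) * w
      previous = begin
        coeff (m ℕ.+ k) m                                    ≈⟨ coeff-closed m k ≡.refl ⟩
        scaledCoeff m k * invFact R inv k                    ≈⟨ *-congˡ (invFact-suc k) ⟩
        scaledCoeff m k * ((1# + K) * invFact R inv (suc k)) ≈⟨ x∙yz≈y∙xz _ _ _ ⟩
        (1# + K) * w                                         ∎
      current : coeff n m ≈ ρ M K * w
      current = begin
        coeff n m                                            ≈⟨ coeff-closed m (suc k) (ℕP.+-suc m k) ⟩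
        scaledCoeff m (suc k) * invFact R inv (suc k)        ≈⟨ *-congʳ (scaledCoeff-suc m k) ⟩
        ρ M K * scaledCoeff m k * invFact R inv (suc k)      ≈⟨ *-assoc _ _ _ ⟩
        ρ M K * w                                            ∎

    turanCoeff-recurrence-diagonal : ∀ m → Ω (F m) (F m) (coeffPrev m m) (coeff m m) ≈ turanCoeff (suc m) m
    turanCoeff-recurrence-diagonal m = begin
      Ω (F m) (F m) (coeffPrev m m) (coeff m m)  ≈⟨ Ω-cong refl (coeffPrev-vanishes (ℕP.≤-refl {m})) (coeff-diagonal m) ⟩
      Ω (F m) (F m) 0# 1#                        ≈⟨ Ω-diagonal (F m) ⟩
      μ (1# + F m) (F m) 1#                      ≈⟨ μ-cong refl (coeff-diagonal m) ⟨
      μ (1# + F m) (F m) (coeff m m)             ∎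

    turanCoeff-recurrence-above : ∀ {n m} → n < m → Ω (F n) (F m) (coeffPrev n m) (coeff n m) ≈ turanCoeff (suc n) m
    turanCoeff-recurrence-above {n} {m} n<m = begin
      Ω (F n) (F m) (coeffPrev n m) (coeff n m)  ≈⟨ Ω-cong refl (coeffPrev-vanishes (ℕP.<⇒≤ n<m)) (coeff-vanishes n<m) ⟩
      Ω (F n) (F m) 0# 0#                        ≈⟨ solve 3 (λ N M r → Syntax.Ω r N M (con (+ 0)) (con (+ 0))
                                                                         := Syntax.μ r (con (+ 1) :+ N) M (con (+ 0))) refl _ _ r ⟩
      μ (1# + F n) (F m) 0#                      ≈⟨ μ-cong refl (coeff-vanishes n<m) ⟨
      μ (1# + F n) (F m) (coeff n m)             ∎

    turanCoeff-recurrence : ∀ n m → Ω (F n) (F m) (coeffPrev n m) (coeff n m) ≈ turanCoeff (suc n) m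
    turanCoeff-recurrence n m with compare m n
    ... | less m k    = turanCoeff-recurrence-interior m k
    ... | equal m     = turanCoeff-recurrence-diagonal m
    ... | greater n k = turanCoeff-recurrence-above (s≤s (ℕP.m≤m+n n k))

  module Expansion (inv : ℕ → Carrier) (inv-correct : ∀ k → fromℕ R (suc k) * inv k ≈ 1#) (r x : Carrier) where
    open IntegerCoefficients using (solve; _:=_; _:+_; _:*_; _:-_; :-_; con)
    open SumsAndProducts
    open RingExpressions _+_ _*_ -_ 1# r using (s; α; Λ; Ω)
    open Coefficients inv inv-correct r

    P : ℕ → Carrier
    P m = prodFrom R 1 m (λ k → x * x + pow R (s + F (k ℕ.+ k) - 1#) 2)

    P-suc : ∀ m → P (suc m) ≈ P m * (x * x + b m)
    P-suc m = prodFrom-snoc 1 m _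

    expand : ℕ → (ℕ → Carrier) → Carrier
    expand N f = sumTo R N (λ m → f m * P m)

    expand-cong : ∀ N {f g : ℕ → Carrier} → (∀ m → f m ≈ g m) → expand N f ≈ expand N g
    expand-cong N f≈g = sumTo-cong N (λ m _ → *-congʳ (f≈g m))

    expand-dropLast : ∀ N {f : ℕ → Carrier} → f (suc N) ≈ 0# → expand (suc N) f ≈ expand N f
    expand-dropLast N fN≈0 = sumTo-dropLast N _ (trans (*-congʳ fN≈0) (zeroˡ _))

    expand-*ˡ : ∀ N y (f : ℕ → Carrier) → y * expand N f ≈ expand N (λ m → y * f m)
    expand-*ˡ N y f = trans (*-distribˡ-sumTo N y _) (sumTo-cong N (λ m _ → sym (*-assoc _ _ _)))

    expand-+ : ∀ N (f g : ℕ → Carrier) → expand N f + expand N g ≈ expand N (λ m → f m + g m)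
    expand-+ N f g = trans (sumTo-+ N _ _) (sumTo-cong N (λ m _ → sym (distribʳ _ _ _)))

    expand-− : ∀ N (f g : ℕ → Carrier) → expand N f - expand N g ≈ expand N (λ m → f m - g m)
    expand-− N f g = trans (sumTo-− N _ _) (sumTo-cong N (λ m _ → sym ([y-z]x≈yx-zx _ _ _)))

    x²-expand : ∀ N (f : ℕ → Carrier) → f (suc N) ≈ 0# →
                x * x * expand (suc N) f ≈ expand (suc N) (λ m → shift f m - b m * f m)
    x²-expand N f fN≈0 = begin
      x * x * expand (suc N) f
        ≈⟨ *-distribˡ-sumTo (suc N) _ _ ⟩
      sumTo R (suc N) (λ m → x * x * (f m * P m))
        ≈⟨ sumTo-cong (suc N) (λ m _ → raise m) ⟩
      sumTo R (suc N) (λ m → f m * P (suc m) - b m * f m * P m)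
        ≈⟨ sumTo-− (suc N) _ _ ⟨
      sumTo R (suc N) (λ m → f m * P (suc m)) - sumTo R (suc N) (λ m → b m * f m * P m)
        ≈⟨ +-congʳ reindex ⟩
      expand (suc N) (shift f) - expand (suc N) (λ m → b m * f m)
        ≈⟨ expand-− (suc N) _ _ ⟩
      expand (suc N) (λ m → shift f m - b m * f m) ∎
      where
      raise : ∀ m → x * x * (f m * P m) ≈ f m * P (suc m) - b m * f m * P m
      raise m = begin
        x * x * (f m * P m)
          ≈⟨ solve 4 (λ X F P B → X :* X :* (F :* P) := F :* (P :* (X :* X :+ B)) :- B :* F :* P) refl x (f m) (P m) (b m) ⟩
        f m * (P m * (x * x + b m)) - b m * f m * P m
          ≈⟨ +-congʳ (*-congˡ (P-suc m)) ⟨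
        f m * P (suc m) - b m * f m * P m ∎
      reindex : sumTo R (suc N) (λ m → f m * P (suc m)) ≈ expand (suc N) (shift f)
      reindex = begin
        sumTo R (suc N) (λ m → f m * P (suc m))            ≈⟨ sumTo-dropLast N _ (trans (*-congʳ fN≈0) (zeroˡ _)) ⟩
        sumTo R N (λ m → f m * P (suc m))                  ≈⟨ +-identityˡ _ ⟨
        0# + sumTo R N (λ m → f m * P (suc m))             ≈⟨ +-congʳ (zeroˡ (P 0)) ⟨
        0# * P 0 + sumTo R N (λ m → f m * P (suc m))       ≈⟨ sumTo-head N _ ⟨
        expand (suc N) (shift f)                           ∎

    square-recurrence : ∀ y p q A →
      (y * q - A * p) * (y * q - A * p)
        ≈ y * y * (q * q) - (1# + 1#) * A * (q * q) - (1# + 1#) * (A * ((y * q - A * p) * p - q * q)) - A * A * (p * p)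
    square-recurrence = solve 4 (λ y p q A → let two = con (+ 1) :+ con (+ 1) in
      (y :* q :- A :* p) :* (y :* q :- A :* p)
      := y :* y :* (q :* q) :- two :* A :* (q :* q) :- two :* (A :* ((y :* q :- A :* p) :* p :- q :* q)) :- A :* A :* (p :* p))
      refl

    turan-recurrence : ∀ y p q A A′ →
      (y * (y * q - A * p) - A′ * q) * q - (y * q - A * p) * (y * q - A * p)
        ≈ A * ((y * q - A * p) * p - q * q) + (A - A′) * (q * q)
    turan-recurrence = solve 5 (λ y p q A A′ →
      (y :* (y :* q :- A :* p) :- A′ :* q) :* q :- (y :* q :- A :* p) :* (y :* q :- A :* p)
      := A :* ((y :* q :- A :* p) :* p :- q :* q) :+ (A :- A′) :* (q :* q))
      refl

    D₋ D₀ : ℕ → Carrier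
    D₋ n = proj₁ (Dpair R r x n)
    D₀ n = proj₂ (Dpair R r x n)

    turan : ℕ → Carrier
    turan n = (x * D₀ n - α (F n) * D₋ n) * D₋ n - D₀ n * D₀ n

    -- Only a_n W_n is expanded: W_0 = −1 has no expansion of this shape, but a_0 = 0.
    record Expansions (n : ℕ) : Set ℓ where
      field
        previous : D₋ n * D₋ n ≈ expand n (coeffPrev n)
        current  : D₀ n * D₀ n ≈ expand n (coeff n)
        turán    : α (F n) * turan n ≈ α (F n) * expand n (turanCoeff n)

    expansions-zero : Expansions 0
    expansions-zero = record
      { previous = trans (zeroˡ _) (sym (zeroˡ _))
      ; current  = *-congʳ (sym (coeff-diagonal 0))
      ; turán    = trans (α₀* _) (sym (α₀* _))
      }
      where
      α₀* : ∀ y → α (F 0) * y ≈ 0#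
      α₀* y = trans (*-congʳ (zeroˡ _)) (zeroˡ y)

    expansions-suc : ∀ {n} → Expansions n → Expansions (suc n)
    expansions-suc {n} E = record
      { previous = current′
      ; current  = square
      ; turán    = *-congˡ turan′
      }
      where
      open Expansions E
      p q A A′ : Carrier
      p = D₋ n
      q = D₀ n
      A = α (F n)
      A′ = α (F (suc n))
      current′ : q * q ≈ expand (suc n) (coeff n)
      current′ = trans current (sym (expand-dropLast n (coeff-vanishes (ℕP.n<1+n n))))
      previous′ : p * p ≈ expand (suc n) (coeffPrev n)
      previous′ = trans previous (sym (expand-dropLast n (coeffPrev-vanishes (ℕP.n≤1+n n))))
      turán′ : A * turan n ≈ A * expand (suc n) (turanCoeff n)
      turán′ = trans turán (*-congˡ (sym (expand-dropLast n μ≈0)))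
        where
        μ≈0 : turanCoeff n (suc n) ≈ 0#
        μ≈0 = trans (-‿cong (trans (*-congˡ (coeffPrev-vanishes (ℕP.n≤1+n n))) (zeroʳ _))) -0#≈0#
      two : Carrier
      two = 1# + 1#
      square : (x * q - A * p) * (x * q - A * p) ≈ expand (suc n) (coeff (suc n))
      square = begin
        (x * q - A * p) * (x * q - A * p)
          ≈⟨ square-recurrence x p q A ⟩
        x * x * (q * q) - two * A * (q * q) - two * (A * turan n) - A * A * (p * p)
          ≈⟨ +-cong (+-cong (+-cong (*-congˡ current′) (-‿cong (*-congˡ current′))) (-‿cong (*-congˡ turán′)))
                    (-‿cong (*-congˡ previous′)) ⟩
        x * x * expand (suc n) (coeff n) - two * A * expand (suc n) (coeff n)
          - two * (A * expand (suc n) (turanCoeff n)) - A * A * expand (suc n) (coeffPrev n)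
          ≈⟨ +-cong (+-cong (+-cong (x²-expand n (coeff n) (coeff-vanishes (ℕP.n<1+n n))) (-‿cong (expand-*ˡ (suc n) _ _)))
                            (-‿cong (trans (*-congˡ (expand-*ˡ (suc n) A _)) (expand-*ˡ (suc n) two _))))
                    (-‿cong (expand-*ˡ (suc n) _ _)) ⟩
        expand (suc n) (λ m → coeffShift n m - b m * coeff n m) - expand (suc n) (λ m → two * A * coeff n m)
          - expand (suc n) (λ m → two * (A * turanCoeff n m)) - expand (suc n) (λ m → A * A * coeffPrev n m)
          ≈⟨ trans (+-congʳ (trans (+-congʳ (expand-− (suc n) _ _)) (expand-− (suc n) _ _))) (expand-− (suc n) _ _) ⟩
        expand (suc n) (λ m → Λ (b m) (F n) (F m) (coeffShift n m) (coeff n m) (coeffPrev n m))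
          ≈⟨ expand-cong (suc n) (coeff-recurrence n) ⟩
        expand (suc n) (coeff (suc n)) ∎
      turan′ : turan (suc n) ≈ expand (suc n) (turanCoeff (suc n))
      turan′ = begin
        turan (suc n)
          ≈⟨ turan-recurrence x p q A A′ ⟩
        A * turan n + (A - A′) * (q * q)
          ≈⟨ +-cong turán′ (*-congˡ current′) ⟩
        A * expand (suc n) (turanCoeff n) + (A - A′) * expand (suc n) (coeff n)
          ≈⟨ +-cong (expand-*ˡ (suc n) _ _) (expand-*ˡ (suc n) _ _) ⟩
        expand (suc n) (λ m → A * turanCoeff n m) + expand (suc n) (λ m → (A - A′) * coeff n m)
          ≈⟨ expand-+ (suc n) _ _ ⟩
        expand (suc n) (λ m → Ω (F n) (F m) (coeffPrev n m) (coeff n m))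
          ≈⟨ expand-cong (suc n) (turanCoeff-recurrence n) ⟩
        expand (suc n) (turanCoeff (suc n)) ∎

    expansions : ∀ n → Expansions n
    expansions zero    = expansions-zero
    expansions (suc n) = expansions-suc (expansions n)

theorem3p3 : ∀ {c ℓ} (R : CommutativeRing c ℓ) →
    let open CommutativeRing R in
    (inv : ℕ → Carrier) →
    (∀ k → fromℕ R (suc k) * inv k ≈ 1#) →
    ∀ (r x : Carrier) (n : ℕ) →
    pow R (D R r x n) 2 ≈ RHS R inv r x n
theorem3p3 R inv inv-correct r x n = begin
  pow R (D R r x n) 2      ≈⟨ *-congˡ (*-identityʳ _) ⟩
  D₀ n * D₀ n              ≈⟨ Expansions.current (expansions n) ⟩
  expand n (coeff n)       ≈⟨ sumTo-cong n (λ m m≤n → *-congʳ (coeff-≤ m≤n)) ⟩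
  RHS R inv r x n          ∎
  where
  open CommutativeRing R
  open import Relation.Binary.Reasoning.Setoid setoid
  open SumsAndProducts R using (sumTo-cong)
  open Coefficients R inv inv-correct r using (coeff; coeff-≤)
  open Expansion R inv inv-correct r x using (D₀; expand; Expansions; expansions)
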